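{- For integers $s,s_1,s_2>0$ and $r,r_1,r_2\geq0$, $$\begin{bmatrix}s\\ r\end{bmatrix}=\begin{bmatrix}r+1\\ s-1\end{bmatrix}$$ and $$\begin{bmatrix}s_1,s_2\\ r_1,r_2\end{bmatrix}=\sum_{\substack{0\leq j\leq r_1\\ 0\leq k\leq s_2-1}}(-1)^k\binom{s_1-1+k}{k}\binom{r_2+j}{j}\begin{bmatrix}r_2+1+j,\ r_1+1-j\\ s_2-1-k,\ s_1-1+k\end{bmatrix}.$$
   Context: Bi-brackets: for integers $s_j>0$, $r_j\ge0$, $\begin{bmatrix}s_1,\dots,s_l\\ r_1,\dots,r_l\end{bmatrix}=\sum_{u_1>\dots>u_l>0,\ v_1,\dots,v_l>0}\prod_{j=1}^l\frac{u_j^{r_j}}{r_j!}\frac{v_j^{s_j-1}}{(s_j-1)!}q^{u_jv_j}\in\mathbb{Q}[[q]]$. -}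

module Defs where

open import Data.Nat using (ℕ; zero; suc; _∸_; _≤ᵇ_; _^_) renaming (_+_ to _+ℕ_; _*_ to _*ℕ_)
open import Data.Nat.Properties using (_!≢0)
open import Data.Nat.Combinatorics using (_C_)
open import Data.Nat.Base using (_!)
open import Data.Integer using (+_)
open import Data.Rational using (ℚ; 0ℚ; 1ℚ; _+_; _*_; -_; _/_)
open import Data.List using (List; []; _∷_)
open import Data.Product using (_×_; _,_)
open import Data.Bool using (if_then_else_)
open import Relation.Binary.PropositionalEquality using (_≡_)

-- Formal power series in Q[[q]], represented by their coefficient sequences.
PowerSeries : Set
PowerSeries = ℕ → ℚ

_≐_ : PowerSeries → PowerSeries → Set
f ≐ g = ∀ N → f N ≡ g N

infix 4 _≐_

sumBelow : ℕ → (ℕ → ℚ) → ℚ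
sumBelow zero    f = 0ℚ
sumBelow (suc n) f = sumBelow n f + f n

ℕ→ℚ : ℕ → ℚ
ℕ→ℚ n = (+ n) / 1

sign : ℕ → ℚ
sign zero    = 1ℚ
sign (suc k) = - sign k

divFact : ℕ → ℕ → ℚ
divFact x e = _/_ (+ (x ^ e)) (e !) {{e !≢0}}

-- bbCoeff ps b N = coefficient-sum over b > u_1 > ... > u_l > 0, v_j > 0,
-- Σ u_j v_j = N, of Π_j u_j^{r_j}/r_j! * v_j^{s_j-1}/(s_j-1)!,
-- where ps = (s_1 , r_1) ∷ ... ∷ (s_l , r_l).
bbCoeff : List (ℕ × ℕ) → ℕ → ℕ → ℚ
bbCoeff [] b N = if N ≤ᵇ 0 then 1ℚ else 0ℚ
bbCoeff ((s , r) ∷ ps) b N =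
  sumBelow b λ u → sumBelow (suc N) λ v →
    if (1 ≤ᵇ u) Data.Bool.∧ (1 ≤ᵇ v) Data.Bool.∧ (u *ℕ v ≤ᵇ N)
    then divFact u r * divFact v (s ∸ 1) * bbCoeff ps u (N ∸ u *ℕ v)
    else 0ℚ

-- The bi-bracket [ s_1,...,s_l ; r_1,...,r_l ] as an element of Q[[q]],
-- given as the list of columns (s_j , r_j).  (u_1 ≤ N for any nonzero term.)
biBracket : List (ℕ × ℕ) → PowerSeries
biBracket ps N = bbCoeff ps (suc N) N

_·ₛ_ : ℚ → PowerSeries → PowerSeries
(c ·ₛ f) N = c * f N

sumSeries : ℕ → (ℕ → PowerSeries) → PowerSeries
sumSeries n F N = sumBelow n λ i → F i N

ℕC : ℕ → ℕ → ℚ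
ℕC n k = ℕ→ℚ (n C k)

-- Depth one: the condition uv = N is symmetric, and exchanging u and v exchanges the
-- columns (s , r) and (r + 1 , s - 1).
-- Depth two: after enlarging all ranges of summation to one box and substituting
-- u₁ = x + y, u₂ = x, v₁ = z, v₂ = w, the coefficient becomes a sum over x, y, z, w ≥ 1
-- with (x + y) z + x w = N (depth-two-canonical).  This condition is invariant under
-- (x , y , z , w) ↦ (z , w , x , y), which interchanges the roles of the u's and v's.
-- What remains is a pointwise identity of weights (weight-expansion), obtained by
-- expanding (z + w)^r₁ and y^(s₂-1) = (-x + (x + y))^(s₂-1) with the binomial theorem
-- for divided powers a^n/n!, itself derived from the library's binomial theorem.

module Submission where

open import Defs
open import Data.Nat using (ℕ; suc; _+_; _∸_; _<_)
open import Data.Rational using (_*_)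
open import Data.List using (_∷_; [])
open import Data.Product using (_×_; _,_)

open import Data.Nat as ℕ using (zero; _≤_; _!; NonZero; s≤s; _<ᵇ_; _≤ᵇ_; _≡ᵇ_)
import Data.Nat.Properties as ℕₚ
open import Data.Nat.Properties using (_!≢0; _!*_!≢0)
open import Data.Nat.Combinatorics using (_C_; nCk≡n!/k![n-k]!; k![n∸k]!∣n!)
open import Data.Nat.DivMod using (m/n*n≡m)
open import Data.Integer as ℤ using (+_)
import Data.Integer.Properties as ℤₚ
open import Data.Rational as ℚ using (ℚ; 0ℚ; 1ℚ; -_; fromℚᵘ)
import Data.Rational.Properties as ℚₚ
open import Data.Rational.Unnormalised as ℚᵘ using (mkℚᵘ; *≡*)
import Data.Rational.Unnormalised.Properties as ℚᵘₚ
open import Data.Fin using (toℕ)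
open import Relation.Nullary.Decidable using (dec⇒maybe)
open import Data.Bool using (Bool; true; false; T; if_then_else_; _∧_)
open import Data.Bool.Properties using (T-∧; T-≡; ∧-comm; ∧-commutativeMonoid)
open import Data.Empty using (⊥-elim)
open import Function.Bundles using (Equivalence; _⇔_; mk⇔)
open import Relation.Nullary using (¬_)
open import Relation.Binary.PropositionalEquality
open import Tactic.RingSolver using (solve-∀)
open import Data.Nat.Tactic.RingSolver using () renaming (solve-∀ to solve-∀ℕ)
open import Tactic.RingSolver.Core.AlmostCommutativeRing using (AlmostCommutativeRing; fromCommutativeRing)
open import Algebra.Bundles using (CommutativeMonoid; CommutativeSemiring; CommutativeRing)
open import Algebra.Properties.CommutativeSemigroup
  (CommutativeMonoid.commutativeSemigroup ℚₚ.+-0-commutativeMonoid) using () renaming (interchange to +-interchange)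
open import Algebra.Properties.CommutativeSemigroup
  (CommutativeMonoid.commutativeSemigroup ∧-commutativeMonoid) using () renaming (x∙yz≈y∙xz to ∧-swap)

ℚ-commutativeSemiring : CommutativeSemiring _ _
ℚ-commutativeSemiring = CommutativeRing.commutativeSemiring ℚₚ.+-*-commutativeRing

open import Algebra.Properties.Semiring.Exp (CommutativeSemiring.semiring ℚ-commutativeSemiring) using (_^_; ^-homo-*)
open import Algebra.Properties.Semiring.Sum (CommutativeSemiring.semiring ℚ-commutativeSemiring) using (sum)
open import Algebra.Properties.Semiring.Mult (CommutativeSemiring.semiring ℚ-commutativeSemiring) using () renaming (_×_ to _×ₙ_)
import Algebra.Properties.CommutativeSemiring.Binomial ℚ-commutativeSemiring as Binomial

ℚ-ring : AlmostCommutativeRing _ _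
ℚ-ring = fromCommutativeRing ℚₚ.+-*-commutativeRing (λ x → dec⇒maybe (0ℚ ℚₚ.≟ x))

fromℚᵘ-+ : ∀ p q → fromℚᵘ p ℚ.+ fromℚᵘ q ≡ fromℚᵘ (p ℚᵘ.+ q)
fromℚᵘ-+ p q = ℚₚ.toℚᵘ-injective (ℚᵘₚ.≃-trans (ℚₚ.toℚᵘ-homo-+ (fromℚᵘ p) (fromℚᵘ q))
  (ℚᵘₚ.≃-trans (ℚᵘₚ.+-cong (ℚₚ.toℚᵘ-fromℚᵘ p) (ℚₚ.toℚᵘ-fromℚᵘ q)) (ℚᵘₚ.≃-sym (ℚₚ.toℚᵘ-fromℚᵘ (p ℚᵘ.+ q)))))

fromℚᵘ-* : ∀ p q → fromℚᵘ p * fromℚᵘ q ≡ fromℚᵘ (p ℚᵘ.* q)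
fromℚᵘ-* p q = ℚₚ.toℚᵘ-injective (ℚᵘₚ.≃-trans (ℚₚ.toℚᵘ-homo-* (fromℚᵘ p) (fromℚᵘ q))
  (ℚᵘₚ.≃-trans (ℚᵘₚ.*-cong (ℚₚ.toℚᵘ-fromℚᵘ p) (ℚₚ.toℚᵘ-fromℚᵘ q)) (ℚᵘₚ.≃-sym (ℚₚ.toℚᵘ-fromℚᵘ (p ℚᵘ.* q)))))

ℕ→ℚ-+ : ∀ a b → ℕ→ℚ (a + b) ≡ ℕ→ℚ a ℚ.+ ℕ→ℚ b
ℕ→ℚ-+ a b = sym (trans (fromℚᵘ-+ (mkℚᵘ (+ a) 0) (mkℚᵘ (+ b) 0))
  (ℚₚ.fromℚᵘ-cong {mkℚᵘ (+ a) 0 ℚᵘ.+ mkℚᵘ (+ b) 0} {mkℚᵘ (+ (a + b)) 0} (*≡* cross)))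
  where
  cross : (+ a ℤ.* + 1 ℤ.+ + b ℤ.* + 1) ℤ.* + 1 ≡ + (a + b) ℤ.* + 1
  cross rewrite ℤₚ.*-identityʳ (+ a) | ℤₚ.*-identityʳ (+ b) | ℤₚ.*-identityʳ (+ a ℤ.+ + b) = sym (ℤₚ.pos-+ a b)

ℕ→ℚ-* : ∀ a b → ℕ→ℚ (a ℕ.* b) ≡ ℕ→ℚ a * ℕ→ℚ b
ℕ→ℚ-* a b = sym (trans (fromℚᵘ-* (mkℚᵘ (+ a) 0) (mkℚᵘ (+ b) 0))
  (ℚₚ.fromℚᵘ-cong {mkℚᵘ (+ a) 0 ℚᵘ.* mkℚᵘ (+ b) 0} {mkℚᵘ (+ (a ℕ.* b)) 0} (*≡* cross)))
  where
  cross : (+ a ℤ.* + b) ℤ.* + 1 ≡ + (a ℕ.* b) ℤ.* + 1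
  cross rewrite ℤₚ.*-identityʳ (+ a ℤ.* + b) | ℤₚ.*-identityʳ (+ (a ℕ.* b)) = sym (ℤₚ.pos-* a b)

ℕ→ℚ-nonZero : ∀ n .{{_ : NonZero n}} → ℕ→ℚ n ≢ 0ℚ
ℕ→ℚ-nonZero (suc n) eq = ≄0 (ℚᵘₚ.≃-trans (ℚᵘₚ.≃-sym (ℚₚ.toℚᵘ-fromℚᵘ (mkℚᵘ (+ suc n) 0))) (ℚₚ.toℚᵘ-cong eq))
  where
  ≄0 : mkℚᵘ (+ suc n) 0 ℚᵘ.≄ mkℚᵘ (+ 0) 0
  ≄0 (*≡* ())

/-*-cancel : ∀ m k .{{_ : NonZero k}} → ((+ m) ℚ./ k) * ℕ→ℚ k ≡ ℕ→ℚ m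
/-*-cancel m (suc k) = trans (fromℚᵘ-* (mkℚᵘ (+ m) k) (mkℚᵘ (+ suc k) 0))
  (ℚₚ.fromℚᵘ-cong {mkℚᵘ (+ m) k ℚᵘ.* mkℚᵘ (+ suc k) 0} {mkℚᵘ (+ m) 0} (*≡* cross))
  where
  cross : (+ m ℤ.* + suc k) ℤ.* + 1 ≡ + m ℤ.* + suc (k ℕ.* 1)
  cross rewrite ℤₚ.*-identityʳ (+ m ℤ.* + suc k) | ℕₚ.*-identityʳ k = refl

*-cancelʳ : ∀ p q c → c ≢ 0ℚ → p * c ≡ q * c → p ≡ q
*-cancelʳ p q c c≢0 eq = begin
  p                ≡⟨ sym (ℚₚ.*-identityʳ p) ⟩
  p * 1ℚ           ≡⟨ cong (p *_) (sym (ℚₚ.*-inverseʳ c)) ⟩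
  p * (c * ℚ.1/ c) ≡⟨ sym (ℚₚ.*-assoc p c _) ⟩
  p * c * ℚ.1/ c   ≡⟨ cong (_* ℚ.1/ c) eq ⟩
  q * c * ℚ.1/ c   ≡⟨ ℚₚ.*-assoc q c _ ⟩
  q * (c * ℚ.1/ c) ≡⟨ cong (q *_) (ℚₚ.*-inverseʳ c) ⟩
  q * 1ℚ           ≡⟨ ℚₚ.*-identityʳ q ⟩
  q                ∎
  where
  open ≡-Reasoning
  instance
    _ : ℚ.NonZero c
    _ = ℚ.≢-nonZero c≢0

sum-cong< : ∀ n {f g : ℕ → ℚ} → (∀ i → i < n → f i ≡ g i) → sumBelow n f ≡ sumBelow n g
sum-cong< zero    eq = refl
sum-cong< (suc n) eq = cong₂ ℚ._+_ (sum-cong< n (λ i i<n → eq i (ℕₚ.m<n⇒m<1+n i<n))) (eq n ℕₚ.≤-refl)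

sum-cong : ∀ n {f g : ℕ → ℚ} → (∀ i → f i ≡ g i) → sumBelow n f ≡ sumBelow n g
sum-cong n eq = sum-cong< n (λ i _ → eq i)

sum-zero : ∀ n {f : ℕ → ℚ} → (∀ i → i < n → f i ≡ 0ℚ) → sumBelow n f ≡ 0ℚ
sum-zero zero    eq = refl
sum-zero (suc n) eq = begin
  sumBelow n _ ℚ.+ _ ≡⟨ cong₂ ℚ._+_ (sum-zero n (λ i i<n → eq i (ℕₚ.m<n⇒m<1+n i<n))) (eq n ℕₚ.≤-refl) ⟩
  0ℚ ℚ.+ 0ℚ          ≡⟨ ℚₚ.+-identityʳ 0ℚ ⟩
  0ℚ                 ∎
  where open ≡-Reasoning

sum-+ : ∀ n (f g : ℕ → ℚ) → sumBelow n (λ i → f i ℚ.+ g i) ≡ sumBelow n f ℚ.+ sumBelow n g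
sum-+ zero    f g = refl
sum-+ (suc n) f g = trans (cong (ℚ._+ (f n ℚ.+ g n)) (sum-+ n f g))
                          (+-interchange (sumBelow n f) (sumBelow n g) (f n) (g n))

sum-*ˡ : ∀ n c (f : ℕ → ℚ) → c * sumBelow n f ≡ sumBelow n (λ i → c * f i)
sum-*ˡ zero    c f = ℚₚ.*-zeroʳ c
sum-*ˡ (suc n) c f = trans (ℚₚ.*-distribˡ-+ c _ _) (cong (ℚ._+ c * f n) (sum-*ˡ n c f))

sum-*ʳ : ∀ n c (f : ℕ → ℚ) → sumBelow n f * c ≡ sumBelow n (λ i → f i * c)
sum-*ʳ n c f = trans (ℚₚ.*-comm _ c) (trans (sum-*ˡ n c f) (sum-cong n (λ i → ℚₚ.*-comm c (f i))))

sum-*-sum : ∀ n m (f g : ℕ → ℚ) → sumBelow n f * sumBelow m g ≡ sumBelow n (λ i → sumBelow m (λ j → f i * g j))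
sum-*-sum n m f g = trans (sum-*ʳ n _ f) (sum-cong n (λ i → sum-*ˡ m (f i) g))

sum-swap : ∀ n m (f : ℕ → ℕ → ℚ) →
           sumBelow n (λ i → sumBelow m (f i)) ≡ sumBelow m (λ j → sumBelow n (λ i → f i j))
sum-swap zero    m f = sym (sum-zero m (λ _ _ → refl))
sum-swap (suc n) m f = trans (cong (ℚ._+ sumBelow m (f n)) (sum-swap n m f))
                             (sym (sum-+ m (λ j → sumBelow n (λ i → f i j)) (f n)))

sum-unroll : ∀ n (f : ℕ → ℚ) → sumBelow (suc n) f ≡ f 0 ℚ.+ sumBelow n (λ i → f (suc i))
sum-unroll zero    f = trans (ℚₚ.+-identityˡ (f 0)) (sym (ℚₚ.+-identityʳ (f 0)))
sum-unroll (suc n) f = trans (cong (ℚ._+ f (suc n)) (sum-unroll n f)) (ℚₚ.+-assoc (f 0) _ (f (suc n)))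

sum-split : ∀ m n (f : ℕ → ℚ) → sumBelow (m + n) f ≡ sumBelow m f ℚ.+ sumBelow n (λ i → f (m + i))
sum-split zero    n f = sym (ℚₚ.+-identityˡ _)
sum-split (suc m) n f = begin
  sumBelow (suc (m + n)) f                                        ≡⟨ sum-unroll (m + n) f ⟩
  f 0 ℚ.+ sumBelow (m + n) (f ∘suc)                               ≡⟨ cong (f 0 ℚ.+_) (sum-split m n (f ∘suc)) ⟩
  f 0 ℚ.+ (sumBelow m (f ∘suc) ℚ.+ sumBelow n (λ i → f (suc m + i))) ≡⟨ sym (ℚₚ.+-assoc (f 0) _ _) ⟩
  f 0 ℚ.+ sumBelow m (f ∘suc) ℚ.+ sumBelow n (λ i → f (suc m + i))   ≡⟨ cong (ℚ._+ sumBelow n (λ i → f (suc m + i))) (sym (sum-unroll m f)) ⟩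
  sumBelow (suc m) f ℚ.+ sumBelow n (λ i → f (suc m + i))          ∎
  where
  open ≡-Reasoning
  _∘suc : (ℕ → ℚ) → ℕ → ℚ
  (g ∘suc) i = g (suc i)

sum-extend : ∀ n m (f : ℕ → ℚ) → n ≤ m → (∀ i → n ≤ i → f i ≡ 0ℚ) → sumBelow m f ≡ sumBelow n f
sum-extend n m f n≤m vanish = begin
  sumBelow m f                                        ≡⟨ cong (λ k → sumBelow k f) (sym (ℕₚ.m+[n∸m]≡n n≤m)) ⟩
  sumBelow (n + (m ∸ n)) f                            ≡⟨ sum-split n (m ∸ n) f ⟩
  sumBelow n f ℚ.+ sumBelow (m ∸ n) (λ i → f (n + i)) ≡⟨ cong (sumBelow n f ℚ.+_) (sum-zero (m ∸ n) (λ i _ → vanish (n + i) (ℕₚ.m≤m+n n i))) ⟩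
  sumBelow n f ℚ.+ 0ℚ                                 ≡⟨ ℚₚ.+-identityʳ _ ⟩
  sumBelow n f                                        ∎
  where open ≡-Reasoning

sum-shift : ∀ n k (f : ℕ → ℚ) → (∀ i → i < k → f i ≡ 0ℚ) → (∀ i → n ≤ i → f i ≡ 0ℚ) →
            sumBelow n f ≡ sumBelow n (λ i → f (k + i))
sum-shift n k f below above = begin
  sumBelow n f                                     ≡⟨ sym (sum-extend n (k + n) f (ℕₚ.m≤n+m n k) above) ⟩
  sumBelow (k + n) f                               ≡⟨ sum-split k n f ⟩
  sumBelow k f ℚ.+ sumBelow n (λ i → f (k + i))    ≡⟨ cong (ℚ._+ sumBelow n (λ i → f (k + i))) (sum-zero k below) ⟩
  0ℚ ℚ.+ sumBelow n (λ i → f (k + i))              ≡⟨ ℚₚ.+-identityˡ _ ⟩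
  sumBelow n (λ i → f (k + i))                     ∎
  where open ≡-Reasoning

sumBelow≡sum : ∀ n (f : ℕ → ℚ) → sumBelow n f ≡ sum {n} (λ i → f (toℕ i))
sumBelow≡sum zero    f = refl
sumBelow≡sum (suc n) f = trans (sum-unroll n f) (cong (f 0 ℚ.+_) (sumBelow≡sum n (λ i → f (suc i))))

×≡ℕ→ℚ* : ∀ n x → n ×ₙ x ≡ ℕ→ℚ n * x
×≡ℕ→ℚ* zero    x = sym (ℚₚ.*-zeroˡ x)
×≡ℕ→ℚ* (suc n) x = begin
  x ℚ.+ n ×ₙ x                  ≡⟨ cong₂ ℚ._+_ (sym (ℚₚ.*-identityˡ x)) (×≡ℕ→ℚ* n x) ⟩
  1ℚ * x ℚ.+ ℕ→ℚ n * x         ≡⟨ sym (ℚₚ.*-distribʳ-+ x 1ℚ (ℕ→ℚ n)) ⟩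
  (ℕ→ℚ 1 ℚ.+ ℕ→ℚ n) * x        ≡⟨ cong (_* x) (sym (ℕ→ℚ-+ 1 n)) ⟩
  ℕ→ℚ (suc n) * x               ∎
  where open ≡-Reasoning

-- Divided powers  a ^ n / n!

1/! : ℕ → ℚ
1/! n = ((+ 1) ℚ./ (n !)) {{n !≢0}}

divPow : ℚ → ℕ → ℚ
divPow a n = a ^ n * 1/! n

!-*-1/! : ∀ n → ℕ→ℚ (n !) * 1/! n ≡ 1ℚ
!-*-1/! n = trans (ℚₚ.*-comm (ℕ→ℚ (n !)) (1/! n)) (/-*-cancel 1 (n !) {{n !≢0}})

ℕ→ℚ-^ : ∀ x e → ℕ→ℚ (x ℕ.^ e) ≡ ℕ→ℚ x ^ e
ℕ→ℚ-^ x zero    = refl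
ℕ→ℚ-^ x (suc e) = trans (ℕ→ℚ-* x (x ℕ.^ e)) (cong (ℕ→ℚ x *_) (ℕ→ℚ-^ x e))

divFact≡divPow : ∀ x e → divFact x e ≡ divPow (ℕ→ℚ x) e
divFact≡divPow x e = *-cancelʳ _ _ (ℕ→ℚ (e !)) (ℕ→ℚ-nonZero (e !) {{e !≢0}}) (begin
  divFact x e * ℕ→ℚ (e !)                     ≡⟨ /-*-cancel (x ℕ.^ e) (e !) {{e !≢0}} ⟩
  ℕ→ℚ (x ℕ.^ e)                               ≡⟨ ℕ→ℚ-^ x e ⟩
  ℕ→ℚ x ^ e                                   ≡⟨ sym (ℚₚ.*-identityʳ _) ⟩
  ℕ→ℚ x ^ e * 1ℚ                              ≡⟨ cong (ℕ→ℚ x ^ e *_) (sym (!-*-1/! e)) ⟩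
  ℕ→ℚ x ^ e * (ℕ→ℚ (e !) * 1/! e)             ≡⟨ rearrange (ℕ→ℚ x ^ e) (ℕ→ℚ (e !)) (1/! e) ⟩
  divPow (ℕ→ℚ x) e * ℕ→ℚ (e !)                ∎)
  where
  open ≡-Reasoning
  rearrange : ∀ a b c → a * (b * c) ≡ a * c * b
  rearrange = solve-∀ ℚ-ring

C*1/! : ∀ n k → k ≤ n → ℕC n k * 1/! n ≡ 1/! k * 1/! (n ∸ k)
C*1/! n k k≤n = *-cancelʳ _ _ (ℕ→ℚ (k !) * ℕ→ℚ ((n ∸ k) !)) k![n-k]!≢0 (begin
  ℕC n k * 1/! n * (ℕ→ℚ (k !) * ℕ→ℚ ((n ∸ k) !))   ≡⟨ cong (λ t → ℕC n k * 1/! n * t) (sym (ℕ→ℚ-* (k !) ((n ∸ k) !))) ⟩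
  ℕC n k * 1/! n * ℕ→ℚ (k ! ℕ.* (n ∸ k) !)          ≡⟨ rearrange₁ (ℕC n k) (1/! n) _ ⟩
  ℕC n k * ℕ→ℚ (k ! ℕ.* (n ∸ k) !) * 1/! n          ≡⟨ cong (_* 1/! n) (sym (ℕ→ℚ-* (n C k) (k ! ℕ.* (n ∸ k) !))) ⟩
  ℕ→ℚ ((n C k) ℕ.* (k ! ℕ.* (n ∸ k) !)) * 1/! n     ≡⟨ cong (λ t → ℕ→ℚ t * 1/! n) C*k!*[n-k]! ⟩
  ℕ→ℚ (n !) * 1/! n                                  ≡⟨ !-*-1/! n ⟩
  1ℚ                                                 ≡⟨ sym (cong₂ _*_ (!-*-1/! k) (!-*-1/! (n ∸ k))) ⟩
  ℕ→ℚ (k !) * 1/! k * (ℕ→ℚ ((n ∸ k) !) * 1/! (n ∸ k)) ≡⟨ rearrange₂ (ℕ→ℚ (k !)) (1/! k) _ _ ⟩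
  1/! k * 1/! (n ∸ k) * (ℕ→ℚ (k !) * ℕ→ℚ ((n ∸ k) !)) ∎)
  where
  open ≡-Reasoning
  C*k!*[n-k]! : (n C k) ℕ.* (k ! ℕ.* (n ∸ k) !) ≡ n !
  C*k!*[n-k]! = trans (cong (ℕ._* (k ! ℕ.* (n ∸ k) !)) (nCk≡n!/k![n-k]! k≤n))
                      (m/n*n≡m {{k !* (n ∸ k) !≢0}} (k![n∸k]!∣n! k≤n))
  k![n-k]!≢0 : ℕ→ℚ (k !) * ℕ→ℚ ((n ∸ k) !) ≢ 0ℚ
  k![n-k]!≢0 = subst (_≢ 0ℚ) (ℕ→ℚ-* (k !) ((n ∸ k) !)) (ℕ→ℚ-nonZero _ {{k !* (n ∸ k) !≢0}})
  rearrange₁ : ∀ a b c → a * b * c ≡ a * c * b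
  rearrange₁ = solve-∀ ℚ-ring
  rearrange₂ : ∀ a b c d → a * b * (c * d) ≡ b * d * (a * c)
  rearrange₂ = solve-∀ ℚ-ring

divPow-binomial : ∀ a b n → divPow (a ℚ.+ b) n ≡ sumBelow (suc n) (λ k → divPow a k * divPow b (n ∸ k))
divPow-binomial a b n = begin
  (a ℚ.+ b) ^ n * 1/! n                         ≡⟨ cong (_* 1/! n) (Binomial.theorem n a b) ⟩
  Binomial.binomialExpansion a b n * 1/! n      ≡⟨ cong (_* 1/! n) (sym (sumBelow≡sum (suc n) term)) ⟩
  sumBelow (suc n) term * 1/! n                 ≡⟨ sum-*ʳ (suc n) (1/! n) term ⟩
  sumBelow (suc n) (λ k → term k * 1/! n)       ≡⟨ sum-cong< (suc n) (λ k k<1+n → termwise k (ℕₚ.≤-pred k<1+n)) ⟩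
  sumBelow (suc n) (λ k → divPow a k * divPow b (n ∸ k)) ∎
  where
  open ≡-Reasoning
  term : ℕ → ℚ
  term k = (n C k) ×ₙ (a ^ k * b ^ (n ∸ k))
  rearrange : ∀ c p q d → c * p * q * d ≡ p * q * (c * d)
  rearrange = solve-∀ ℚ-ring
  rearrange′ : ∀ p q c d → p * q * (c * d) ≡ p * c * (q * d)
  rearrange′ = solve-∀ ℚ-ring
  termwise : ∀ k → k ≤ n → term k * 1/! n ≡ divPow a k * divPow b (n ∸ k)
  termwise k k≤n = begin
    term k * 1/! n                                  ≡⟨ cong (_* 1/! n) (×≡ℕ→ℚ* (n C k) _) ⟩
    ℕC n k * (a ^ k * b ^ (n ∸ k)) * 1/! n          ≡⟨ sym (cong (_* 1/! n) (ℚₚ.*-assoc (ℕC n k) _ _)) ⟩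
    ℕC n k * a ^ k * b ^ (n ∸ k) * 1/! n            ≡⟨ rearrange (ℕC n k) (a ^ k) _ _ ⟩
    a ^ k * b ^ (n ∸ k) * (ℕC n k * 1/! n)          ≡⟨ cong (a ^ k * b ^ (n ∸ k) *_) (C*1/! n k k≤n) ⟩
    a ^ k * b ^ (n ∸ k) * (1/! k * 1/! (n ∸ k))     ≡⟨ rearrange′ (a ^ k) _ _ _ ⟩
    divPow a k * divPow b (n ∸ k)                   ∎

divPow-neg : ∀ a k → divPow (- a) k ≡ sign k * divPow a k
divPow-neg a k = trans (cong (_* 1/! k) (^-neg k)) (ℚₚ.*-assoc (sign k) (a ^ k) (1/! k))
  where
  ^-neg : ∀ k → (- a) ^ k ≡ sign k * a ^ k
  ^-neg zero    = sym (ℚₚ.*-identityˡ 1ℚ)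
  ^-neg (suc k) = trans (cong (- a *_) (^-neg k)) (neg-swap a (sign k) (a ^ k))
    where
    neg-swap : ∀ a s p → - a * (s * p) ≡ - s * (a * p)
    neg-swap = solve-∀ ℚ-ring

divPow-product : ∀ x a k → divPow x a * divPow x k ≡ ℕC (a + k) k * divPow x (a + k)
divPow-product x a k = sym (begin
  ℕC (a + k) k * (x ^ (a + k) * 1/! (a + k))    ≡⟨ rearrange (ℕC (a + k) k) (x ^ (a + k)) (1/! (a + k)) ⟩
  x ^ (a + k) * (ℕC (a + k) k * 1/! (a + k))    ≡⟨ cong₂ _*_ (^-homo-* x a k) (C*1/! (a + k) k (ℕₚ.m≤n+m k a)) ⟩
  x ^ a * x ^ k * (1/! k * 1/! (a + k ∸ k))     ≡⟨ cong (λ i → x ^ a * x ^ k * (1/! k * 1/! i)) (ℕₚ.m+n∸n≡m a k) ⟩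
  x ^ a * x ^ k * (1/! k * 1/! a)               ≡⟨ rearrange′ (x ^ a) _ _ _ ⟩
  divPow x a * divPow x k                       ∎)
  where
  open ≡-Reasoning
  rearrange : ∀ c p i → c * (p * i) ≡ p * (c * i)
  rearrange = solve-∀ ℚ-ring
  rearrange′ : ∀ p q i j → p * q * (i * j) ≡ p * j * (q * i)
  rearrange′ = solve-∀ ℚ-ring

dual-term : ∀ (X Z W V : ℚ) s t r₁ r₂ j k →
  divPow Z j * divPow W (r₁ ∸ j) * (divPow (- X) k * divPow V (t ∸ k)) * (divPow X s * divPow Z r₂)
  ≡ sign k * ℕC (s + k) k * ℕC (r₂ + j) j
    * (divPow V (t ∸ k) * divPow Z (r₂ + j) * (divPow X (s + k) * divPow W (r₁ ∸ j)))
dual-term X Z W V s t r₁ r₂ j k = begin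
  Zj * Wj * (divPow (- X) k * Vk) * (Xs * Zr)        ≡⟨ cong (λ e → Zj * Wj * (e * Vk) * (Xs * Zr)) (divPow-neg X k) ⟩
  Zj * Wj * (sign k * Xk * Vk) * (Xs * Zr)           ≡⟨ collect Zj Wj (sign k) Xk Vk Xs Zr ⟩
  sign k * (Zr * Zj) * (Xs * Xk) * (Vk * Wj)         ≡⟨ cong₂ (λ p q → sign k * p * q * (Vk * Wj)) (divPow-product Z r₂ j) (divPow-product X s k) ⟩
  sign k * (ℕC (r₂ + j) j * divPow Z (r₂ + j)) * (ℕC (s + k) k * divPow X (s + k)) * (Vk * Wj)
    ≡⟨ distribute (sign k) (ℕC (r₂ + j) j) _ (ℕC (s + k) k) _ Vk Wj ⟩
  sign k * ℕC (s + k) k * ℕC (r₂ + j) j * (Vk * divPow Z (r₂ + j) * (divPow X (s + k) * Wj)) ∎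
  where
  open ≡-Reasoning
  Zj = divPow Z j
  Zr = divPow Z r₂
  Xk = divPow X k
  Xs = divPow X s
  Wj = divPow W (r₁ ∸ j)
  Vk = divPow V (t ∸ k)
  collect : ∀ zj wj σ xk vk xs zr → zj * wj * (σ * xk * vk) * (xs * zr) ≡ σ * (zr * zj) * (xs * xk) * (vk * wj)
  collect = solve-∀ ℚ-ring
  distribute : ∀ σ c z c′ x v w → σ * (c * z) * (c′ * x) * (v * w) ≡ σ * c′ * c * (v * z * (x * w))
  distribute = solve-∀ ℚ-ring

-- The identity behind the second formula, in divided powers a^[n] = a^n/n!:
--   (Z+W)^[r₁] X^[s] · Z^[r₂] Y^[t]
--     = Σ_{j ≤ r₁} Σ_{k ≤ t} (-1)^k C(s+k,k) C(r₂+j,j) (X+Y)^[t-k] Z^[r₂+j] · X^[s+k] W^[r₁-j],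
-- obtained by expanding (Z+W)^[r₁] and Y^[t] = (-X + (X+Y))^[t] binomially.
dual-expansion : ∀ (X Y Z W : ℚ) s t r₁ r₂ →
  divPow (Z ℚ.+ W) r₁ * divPow X s * (divPow Z r₂ * divPow Y t)
  ≡ sumBelow (suc r₁) (λ j → sumBelow (suc t) (λ k → sign k * ℕC (s + k) k * ℕC (r₂ + j) j
      * (divPow (X ℚ.+ Y) (t ∸ k) * divPow Z (r₂ + j) * (divPow X (s + k) * divPow W (r₁ ∸ j)))))
dual-expansion X Y Z W s t r₁ r₂ = begin
  divPow (Z ℚ.+ W) r₁ * Xs * (Zr * divPow Y t)
    ≡⟨ cong₂ (λ p q → p * Xs * (Zr * q)) (divPow-binomial Z W r₁)
             (trans (cong (λ e → divPow e t) (Y≡-X+V X Y)) (divPow-binomial (- X) (X ℚ.+ Y) t)) ⟩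
  sumBelow (suc r₁) f * Xs * (Zr * sumBelow (suc t) g)     ≡⟨ regroup (sumBelow (suc r₁) f) Xs Zr _ ⟩
  sumBelow (suc r₁) f * sumBelow (suc t) g * (Xs * Zr)     ≡⟨ cong (_* (Xs * Zr)) (sum-*-sum (suc r₁) (suc t) f g) ⟩
  sumBelow (suc r₁) (λ j → sumBelow (suc t) (λ k → f j * g k)) * (Xs * Zr)
    ≡⟨ sum-*ʳ (suc r₁) (Xs * Zr) _ ⟩
  sumBelow (suc r₁) (λ j → sumBelow (suc t) (λ k → f j * g k) * (Xs * Zr))
    ≡⟨ sum-cong (suc r₁) (λ j → trans (sum-*ʳ (suc t) (Xs * Zr) _)
                                      (sum-cong (suc t) (dual-term X Z W (X ℚ.+ Y) s t r₁ r₂ j))) ⟩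
  sumBelow (suc r₁) (λ j → sumBelow (suc t) (λ k → sign k * ℕC (s + k) k * ℕC (r₂ + j) j
      * (divPow (X ℚ.+ Y) (t ∸ k) * divPow Z (r₂ + j) * (divPow X (s + k) * divPow W (r₁ ∸ j))))) ∎
  where
  open ≡-Reasoning
  Xs = divPow X s
  Zr = divPow Z r₂
  f : ℕ → ℚ
  f j = divPow Z j * divPow W (r₁ ∸ j)
  g : ℕ → ℚ
  g k = divPow (- X) k * divPow (X ℚ.+ Y) (t ∸ k)
  Y≡-X+V : ∀ x y → y ≡ - x ℚ.+ (x ℚ.+ y)
  Y≡-X+V = solve-∀ ℚ-ring
  regroup : ∀ a p q b → a * p * (q * b) ≡ a * b * (p * q)
  regroup = solve-∀ ℚ-ring

weight : ℕ → ℕ → ℕ → ℕ → ℚ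
weight s r u v = divFact u r * divFact v (s ∸ 1)

weight-expansion : ∀ s₁ r₁ s₂ r₂ x y z w →
  weight s₁ r₁ (z + w) x * weight s₂ r₂ z y
  ≡ sumBelow (suc r₁) (λ j → sumBelow (s₂ ∸ 1 + 1) (λ k → sign k * ℕC (s₁ ∸ 1 + k) k * ℕC (r₂ + j) j
      * (weight (r₂ + 1 + j) (s₂ ∸ 1 ∸ k) (x + y) z * weight (r₁ + 1 ∸ j) (s₁ ∸ 1 + k) x w)))
weight-expansion s₁ r₁ s₂ r₂ x y z w = begin
  weight s₁ r₁ (z + w) x * weight s₂ r₂ z y
    ≡⟨ cong₂ _*_ (cong₂ _*_ (trans (divFact≡divPow (z + w) r₁) (cong (λ e → divPow e r₁) (ℕ→ℚ-+ z w)))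
                            (divFact≡divPow x s))
                 (cong₂ _*_ (divFact≡divPow z r₂) (divFact≡divPow y t)) ⟩
  divPow (Z ℚ.+ W) r₁ * divPow X s * (divPow Z r₂ * divPow Y t)
    ≡⟨ dual-expansion X Y Z W s t r₁ r₂ ⟩
  sumBelow (suc r₁) (λ j → sumBelow (suc t) (dual j))
    ≡⟨ sum-cong (suc r₁) (λ j → trans (cong (λ n → sumBelow n (dual j)) (ℕₚ.+-comm 1 t))
           (sum-cong (t + 1) (λ k → cong (sign k * ℕC (s + k) k * ℕC (r₂ + j) j *_) (sym (dual-weights j k))))) ⟩
  sumBelow (suc r₁) (λ j → sumBelow (t + 1) (λ k → sign k * ℕC (s + k) k * ℕC (r₂ + j) j
      * (weight (r₂ + 1 + j) (t ∸ k) (x + y) z * weight (r₁ + 1 ∸ j) (s + k) x w))) ∎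
  where
  open ≡-Reasoning
  s = s₁ ∸ 1
  t = s₂ ∸ 1
  X = ℕ→ℚ x
  Y = ℕ→ℚ y
  Z = ℕ→ℚ z
  W = ℕ→ℚ w
  dual : ℕ → ℕ → ℚ
  dual j k = sign k * ℕC (s + k) k * ℕC (r₂ + j) j
    * (divPow (X ℚ.+ Y) (t ∸ k) * divPow Z (r₂ + j) * (divPow X (s + k) * divPow W (r₁ ∸ j)))
  dual-weights : ∀ j k → weight (r₂ + 1 + j) (t ∸ k) (x + y) z * weight (r₁ + 1 ∸ j) (s + k) x w
                       ≡ divPow (X ℚ.+ Y) (t ∸ k) * divPow Z (r₂ + j) * (divPow X (s + k) * divPow W (r₁ ∸ j))
  dual-weights j k = cong₂ _*_
    (cong₂ _*_ (trans (divFact≡divPow (x + y) (t ∸ k)) (cong (λ e → divPow e (t ∸ k)) (ℕ→ℚ-+ x y)))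
               (trans (cong (divFact z) r₂+1+j∸1≡r₂+j) (divFact≡divPow z (r₂ + j))))
    (cong₂ _*_ (divFact≡divPow x (s + k))
               (trans (cong (divFact w) r₁+1∸j∸1≡r₁∸j) (divFact≡divPow w (r₁ ∸ j))))
    where
    r₂+1+j∸1≡r₂+j : r₂ + 1 + j ∸ 1 ≡ r₂ + j
    r₂+1+j∸1≡r₂+j = cong (_∸ 1) (trans (ℕₚ.+-assoc r₂ 1 j) (ℕₚ.+-suc r₂ j))
    r₁+1∸j∸1≡r₁∸j : r₁ + 1 ∸ j ∸ 1 ≡ r₁ ∸ j
    r₁+1∸j∸1≡r₁∸j = trans (ℕₚ.∸-+-assoc (r₁ + 1) j 1) (cong₂ _∸_ (ℕₚ.+-comm r₁ 1) (ℕₚ.+-comm j 1))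

infixr 5 [_]·_
[_]·_ : Bool → ℚ → ℚ
[ b ]· x = if b then x else 0ℚ

[]·-∧ : ∀ a b x → [ a ∧ b ]· x ≡ [ a ]· [ b ]· x
[]·-∧ true  b x = refl
[]·-∧ false b x = refl

[]·-*ˡ : ∀ c b x → c * ([ b ]· x) ≡ [ b ]· c * x
[]·-*ˡ c true  x = refl
[]·-*ˡ c false x = ℚₚ.*-zeroʳ c

[]·-indicator : ∀ x b → x * ([ b ]· 1ℚ) ≡ [ b ]· x
[]·-indicator x true  = ℚₚ.*-identityʳ x
[]·-indicator x false = ℚₚ.*-zeroʳ x

[]·-sum : ∀ b n f → [ b ]· sumBelow n f ≡ sumBelow n (λ i → [ b ]· f i)
[]·-sum true  n f = refl
[]·-sum false n f = sym (sum-zero n (λ _ _ → refl))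

[]·-false : ∀ {b} x → ¬ T b → [ b ]· x ≡ 0ℚ
[]·-false {true}  x ¬b = ⊥-elim (¬b _)
[]·-false {false} x ¬b = refl

T-∧⁻ : ∀ {a b} → T (a ∧ b) → T a × T b
T-∧⁻ = Equivalence.to T-∧

T-∧⁺ : ∀ {a b} → T a × T b → T (a ∧ b)
T-∧⁺ = Equivalence.from T-∧

[]·-⇔ : ∀ {a b} x → T a ⇔ T b → [ a ]· x ≡ [ b ]· x
[]·-⇔ {a} {b} x a⇔b with a | b | Equivalence.to a⇔b | Equivalence.from a⇔b
... | true  | true  | _ | _ = refl
... | false | false | _ | _ = refl
... | true  | false | to | _ = ⊥-elim (to _)
... | false | true  | _ | from = ⊥-elim (from _)

sum-restrict : ∀ n m (f : ℕ → ℚ) → n ≤ m → sumBelow n f ≡ sumBelow m (λ i → [ i <ᵇ n ]· f i)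
sum-restrict n m f n≤m = sym (trans (sum-extend n m _ n≤m (λ i n≤i → []·-false (f i) (λ i<n → ℕₚ.<⇒≱ (ℕₚ.<ᵇ⇒< i n i<n) n≤i)))
                                    (sum-cong< n (λ i i<n → cong ([_]· f i) (T⇒≡true (ℕₚ.<⇒<ᵇ i<n)))))
  where
  T⇒≡true : ∀ {b} → T b → b ≡ true
  T⇒≡true = Equivalence.to T-≡

admissible : ℕ → ℕ → ℕ → Bool
admissible n u v = (1 ≤ᵇ u) ∧ (1 ≤ᵇ v) ∧ (u ℕ.* v ≤ᵇ n)

Admissible : ℕ → ℕ → ℕ → Set
Admissible n u v = 1 ≤ u × 1 ≤ v × u ℕ.* v ≤ n

admissible-spec : ∀ n u v → T (admissible n u v) ⇔ Admissible n u v
admissible-spec n u v = mk⇔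
  (λ t → let (1≤u , t′) = T-∧⁻ t ; (1≤v , uv≤n) = T-∧⁻ t′
         in ℕₚ.≤ᵇ⇒≤ 1 u 1≤u , ℕₚ.≤ᵇ⇒≤ 1 v 1≤v , ℕₚ.≤ᵇ⇒≤ (u ℕ.* v) n uv≤n)
  (λ (1≤u , 1≤v , uv≤n) → T-∧⁺ (ℕₚ.≤⇒≤ᵇ 1≤u , T-∧⁺ (ℕₚ.≤⇒≤ᵇ 1≤v , ℕₚ.≤⇒≤ᵇ uv≤n)))

bbCoeff-box : ∀ M s r ps b n → b ≤ M → n < M →
  bbCoeff ((s , r) ∷ ps) b n
  ≡ sumBelow M (λ u → sumBelow M (λ v → [ (u <ᵇ b) ∧ admissible n u v ]· weight s r u v * bbCoeff ps u (n ∸ u ℕ.* v)))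
bbCoeff-box M s r ps b n b≤M n<M = begin
  sumBelow b (λ u → sumBelow (suc n) (term u))                 ≡⟨ sum-restrict b M _ b≤M ⟩
  sumBelow M (λ u → [ u <ᵇ b ]· sumBelow (suc n) (term u))     ≡⟨ sum-cong M (λ u → cong ([ u <ᵇ b ]·_) (sym (sum-extend (suc n) M (term u) n<M (beyond u)))) ⟩
  sumBelow M (λ u → [ u <ᵇ b ]· sumBelow M (term u))           ≡⟨ sum-cong M (λ u → trans ([]·-sum (u <ᵇ b) M (term u)) (sum-cong M (λ v → sym ([]·-∧ (u <ᵇ b) _ _)))) ⟩
  sumBelow M (λ u → sumBelow M (λ v → [ (u <ᵇ b) ∧ admissible n u v ]· weight s r u v * bbCoeff ps u (n ∸ u ℕ.* v))) ∎
  where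
  open ≡-Reasoning
  term : ℕ → ℕ → ℚ
  term u v = [ admissible n u v ]· weight s r u v * bbCoeff ps u (n ∸ u ℕ.* v)
  -- a term with v > n is not admissible, as v ≤ u v ≤ n
  beyond : ∀ u v → suc n ≤ v → term u v ≡ 0ℚ
  beyond u v n<v = []·-false _ (λ adm →
    let (1≤u , _ , uv≤n) = Equivalence.to (admissible-spec n u v) adm
    in ℕₚ.<⇒≱ n<v (ℕₚ.≤-trans (ℕₚ.m≤n*m v u {{ℕ.>-nonZero 1≤u}}) uv≤n))

bbCoeff₁-box : ∀ M s r b n → b ≤ M → n < M →
  bbCoeff ((s , r) ∷ []) b n
  ≡ sumBelow M (λ u → sumBelow M (λ v → [ ((u <ᵇ b) ∧ admissible n u v) ∧ (n ∸ u ℕ.* v ≤ᵇ 0) ]· weight s r u v))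
bbCoeff₁-box M s r b n b≤M n<M = trans (bbCoeff-box M s r [] b n b≤M n<M)
  (sum-cong M (λ u → sum-cong M (λ v → trans (cong ([ _ ]·_) ([]·-indicator (weight s r u v) _)) (sym ([]·-∧ ((u <ᵇ b) ∧ admissible n u v) _ _)))))

admissible-sym : ∀ n u v → admissible n u v ≡ admissible n v u
admissible-sym n u v = trans (cong (λ e → (1 ≤ᵇ u) ∧ (1 ≤ᵇ v) ∧ (e ≤ᵇ n)) (ℕₚ.*-comm u v))
                             (∧-swap (1 ≤ᵇ u) (1 ≤ᵇ v) (v ℕ.* u ≤ᵇ n))

depth-one-duality : ∀ s r → biBracket ((s , r) ∷ []) ≐ biBracket ((r + 1 , s ∸ 1) ∷ [])
depth-one-duality s r N = trans (sum-swap (suc N) (suc N) term) (sum-cong (suc N) (λ v → sum-cong (suc N) (λ u → exchange u v)))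
  where
  term : ℕ → ℕ → ℚ
  term u v = [ admissible N u v ]· weight s r u v * ([ N ∸ u ℕ.* v ≤ᵇ 0 ]· 1ℚ)
  exchange : ∀ u v → term u v ≡ [ admissible N v u ]· weight (r + 1) (s ∸ 1) v u * ([ N ∸ v ℕ.* u ≤ᵇ 0 ]· 1ℚ)
  exchange u v = cong₂ [_]·_ (admissible-sym N u v) (cong₂ _*_ swap-weights (cong (λ e → [ N ∸ e ≤ᵇ 0 ]· 1ℚ) (ℕₚ.*-comm u v)))
    where
    swap-weights : weight s r u v ≡ weight (r + 1) (s ∸ 1) v u
    swap-weights = trans (ℚₚ.*-comm (divFact u r) (divFact v (s ∸ 1)))
                         (cong (λ e → divFact v (s ∸ 1) * divFact u e) (sym (ℕₚ.m+n∸n≡m r 1)))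

Σ⁴ : ℕ → (ℕ → ℕ → ℕ → ℕ → ℚ) → ℚ
Σ⁴ M F = sumBelow M (λ x → sumBelow M (λ y → sumBelow M (λ z → sumBelow M (λ w → F x y z w))))

Σ⁴-cong : ∀ M {F G : ℕ → ℕ → ℕ → ℕ → ℚ} → (∀ x y z w → F x y z w ≡ G x y z w) → Σ⁴ M F ≡ Σ⁴ M G
Σ⁴-cong M eq = sum-cong M (λ x → sum-cong M (λ y → sum-cong M (λ z → sum-cong M (eq x y z))))

Σ⁴-third-first : ∀ M F → Σ⁴ M F ≡ Σ⁴ M (λ c a b d → F a b c d)
Σ⁴-third-first M F = trans (sum-cong M (λ a → sum-swap M M (λ b c → sumBelow M (F a b c))))
                           (sum-swap M M (λ a c → sumBelow M (λ b → sumBelow M (F a b c))))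

Σ⁴-rotate : ∀ M F → Σ⁴ M F ≡ Σ⁴ M (λ c d a b → F a b c d)
Σ⁴-rotate M F = begin
  Σ⁴ M F                                                                        ≡⟨ Σ⁴-third-first M F ⟩
  Σ⁴ M (λ c a b d → F a b c d)                                                  ≡⟨ sum-cong M (λ c → sum-cong M (λ a → sum-swap M M (λ b d → F a b c d))) ⟩
  sumBelow M (λ c → sumBelow M (λ a → sumBelow M (λ d → sumBelow M (λ b → F a b c d))))
    ≡⟨ sum-cong M (λ c → sum-swap M M (λ a d → sumBelow M (λ b → F a b c d))) ⟩
  Σ⁴ M (λ c d a b → F a b c d)                                                  ∎
  where open ≡-Reasoning

Σ⁴-*ˡ : ∀ M c F → c * Σ⁴ M F ≡ Σ⁴ M (λ x y z w → c * F x y z w)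
Σ⁴-*ˡ M c F = trans (sum-*ˡ M c _) (sum-cong M (λ x → trans (sum-*ˡ M c _) (sum-cong M (λ y →
              trans (sum-*ˡ M c _) (sum-cong M (λ z → sum-*ˡ M c (F x y z)))))))

sum-Σ⁴ : ∀ n M (F : ℕ → ℕ → ℕ → ℕ → ℕ → ℚ) →
         sumBelow n (λ i → Σ⁴ M (F i)) ≡ Σ⁴ M (λ x y z w → sumBelow n (λ i → F i x y z w))
sum-Σ⁴ n M F = trans (sum-swap n M _) (sum-cong M (λ x → trans (sum-swap n M _) (sum-cong M (λ y →
               trans (sum-swap n M _) (sum-cong M (λ z → sum-swap n M (λ i → F i x y z)))))))

Σ⁴-linear : ∀ n m M (c : ℕ → ℕ → ℚ) (b : ℕ → ℕ → ℕ → ℕ → Bool) (F : ℕ → ℕ → ℕ → ℕ → ℕ → ℕ → ℚ) →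
  sumBelow n (λ j → sumBelow m (λ k → c j k * Σ⁴ M (λ x y z w → [ b x y z w ]· F j k x y z w)))
  ≡ Σ⁴ M (λ x y z w → [ b x y z w ]· sumBelow n (λ j → sumBelow m (λ k → c j k * F j k x y z w)))
Σ⁴-linear n m M c b F = begin
  sumBelow n (λ j → sumBelow m (λ k → c j k * Σ⁴ M (λ x y z w → [ b x y z w ]· F j k x y z w)))
    ≡⟨ sum-cong n (λ j → trans (sum-cong m (λ k → Σ⁴-*ˡ M (c j k) _)) (sum-Σ⁴ m M _)) ⟩
  sumBelow n (λ j → Σ⁴ M (λ x y z w → sumBelow m (λ k → c j k * ([ b x y z w ]· F j k x y z w))))
    ≡⟨ sum-Σ⁴ n M _ ⟩
  Σ⁴ M (λ x y z w → sumBelow n (λ j → sumBelow m (λ k → c j k * ([ b x y z w ]· F j k x y z w))))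
    ≡⟨ Σ⁴-cong M (λ x y z w → guard-out (b x y z w) (λ j k → F j k x y z w)) ⟩
  Σ⁴ M (λ x y z w → [ b x y z w ]· sumBelow n (λ j → sumBelow m (λ k → c j k * F j k x y z w))) ∎
  where
  open ≡-Reasoning
  guard-out : ∀ g (G : ℕ → ℕ → ℚ) →
    sumBelow n (λ j → sumBelow m (λ k → c j k * ([ g ]· G j k))) ≡ [ g ]· sumBelow n (λ j → sumBelow m (λ k → c j k * G j k))
  guard-out g G = sym (trans ([]·-sum g n _) (sum-cong n (λ j → trans ([]·-sum g m _) (sum-cong m (λ k → sym ([]·-*ˡ (c j k) g (G j k)))))))

chain : ℕ → ℕ → ℕ → ℕ → ℕ → Bool
chain N u v u′ v′ = ((u <ᵇ suc N) ∧ admissible N u v)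
                  ∧ (((u′ <ᵇ u) ∧ admissible (N ∸ u ℕ.* v) u′ v′) ∧ (N ∸ u ℕ.* v ∸ u′ ℕ.* v′ ≤ᵇ 0))

Chain : ℕ → ℕ → ℕ → ℕ → ℕ → Set
Chain N u v u′ v′ = u < suc N × Admissible N u v × u′ < u × Admissible (N ∸ u ℕ.* v) u′ v′
                  × N ∸ u ℕ.* v ∸ u′ ℕ.* v′ ≤ 0

chain-spec : ∀ N u v u′ v′ → T (chain N u v u′ v′) ⇔ Chain N u v u′ v′
chain-spec N u v u′ v′ = mk⇔
  (λ t → let (outer , inner) = T-∧⁻ t ; (u<M , adm) = T-∧⁻ outer
             (tail , used-up) = T-∧⁻ inner ; (u′<u , adm′) = T-∧⁻ tail
         in ℕₚ.<ᵇ⇒< u (suc N) u<M , to (admissible-spec N u v) adm , ℕₚ.<ᵇ⇒< u′ u u′<u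
            , to (admissible-spec (N ∸ u ℕ.* v) u′ v′) adm′ , ℕₚ.≤ᵇ⇒≤ _ 0 used-up)
  (λ (u<M , adm , u′<u , adm′ , used-up) →
     T-∧⁺ (T-∧⁺ (ℕₚ.<⇒<ᵇ u<M , from (admissible-spec N u v) adm)
         , T-∧⁺ (T-∧⁺ (ℕₚ.<⇒<ᵇ u′<u , from (admissible-spec (N ∸ u ℕ.* v) u′ v′) adm′) , ℕₚ.≤⇒≤ᵇ used-up)))
  where open Equivalence

[]·-*-sum² : ∀ a A M (b : ℕ → ℕ → Bool) (B : ℕ → ℕ → ℚ) →
  [ a ]· A * sumBelow M (λ i → sumBelow M (λ j → [ b i j ]· B i j))
  ≡ sumBelow M (λ i → sumBelow M (λ j → [ a ∧ b i j ]· A * B i j))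
[]·-*-sum² false A M b B = sym (sum-zero M (λ _ _ → sum-zero M (λ _ _ → refl)))
[]·-*-sum² true  A M b B = trans (sum-*ˡ M A _) (sum-cong M (λ i → trans (sum-*ˡ M A _)
                                 (sum-cong M (λ j → []·-*ˡ A (b i j) (B i j)))))

bbCoeff₂-box : ∀ s₁ r₁ s₂ r₂ N →
  biBracket ((s₁ , r₁) ∷ (s₂ , r₂) ∷ []) N
  ≡ Σ⁴ (suc N) (λ u v u′ v′ → [ chain N u v u′ v′ ]· weight s₁ r₁ u v * weight s₂ r₂ u′ v′)
bbCoeff₂-box s₁ r₁ s₂ r₂ N = trans (bbCoeff-box M s₁ r₁ ((s₂ , r₂) ∷ []) M N ℕₚ.≤-refl ℕₚ.≤-refl)
  (sum-cong< M (λ u u<M → sum-cong M (λ v →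
    trans (cong (λ e → [ (u <ᵇ M) ∧ admissible N u v ]· weight s₁ r₁ u v * e)
                (bbCoeff₁-box M s₂ r₂ u (N ∸ u ℕ.* v) (ℕₚ.<⇒≤ u<M) (s≤s (ℕₚ.m∸n≤m N (u ℕ.* v)))))
          ([]·-*-sum² _ (weight s₁ r₁ u v) M _ (weight s₂ r₂)))))
  where M = suc N

-- Writing u = x + y and u′ = x turns the guard u′ < u into y ≥ 1; the terms
-- with u ≥ M or u < u′ dropped or added by this substitution vanish.
chain-shift : ∀ N (F : ℕ → ℕ → ℕ → ℕ → ℚ) →
  Σ⁴ (suc N) (λ u v u′ v′ → [ chain N u v u′ v′ ]· F u v u′ v′)
  ≡ Σ⁴ (suc N) (λ x y z w → [ chain N (x + y) z x w ]· F (x + y) z x w)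
chain-shift N F = trans (Σ⁴-third-first M _) (sum-cong M (λ x → sum-shift M x (Φ x) (below x) (above x)))
  where
  M = suc N
  Φ : ℕ → ℕ → ℚ
  Φ x u = sumBelow M (λ v → sumBelow M (λ v′ → [ chain N u v x v′ ]· F u v x v′))
  vanishing : ∀ x u → (∀ v v′ → ¬ T (chain N u v x v′)) → Φ x u ≡ 0ℚ
  vanishing x u never = sum-zero M (λ v _ → sum-zero M (λ v′ _ → []·-false _ (never v v′)))
  below : ∀ x u → u < x → Φ x u ≡ 0ℚ
  below x u u<x = vanishing x u (λ v v′ t →
    let (_ , _ , x<u , _) = Equivalence.to (chain-spec N u v x v′) t in ℕₚ.<-asym u<x x<u)
  above : ∀ x u → M ≤ u → Φ x u ≡ 0ℚ
  above x u M≤u = vanishing x u (λ v v′ t →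
    let (u<M , _) = Equivalence.to (chain-spec N u v x v′) t in ℕₚ.<⇒≱ u<M M≤u)

positive : ℕ → ℕ → ℕ → ℕ → Bool
positive x y z w = ((1 ≤ᵇ x) ∧ (1 ≤ᵇ y)) ∧ ((1 ≤ᵇ z) ∧ (1 ≤ᵇ w))

canonical : ℕ → ℕ → ℕ → ℕ → ℕ → Bool
canonical N x y z w = positive x y z w ∧ ((x + y) ℕ.* z + x ℕ.* w ≡ᵇ N)

canonical-spec : ∀ N x y z w →
  T (canonical N x y z w) ⇔ (1 ≤ x × 1 ≤ y × 1 ≤ z × 1 ≤ w × (x + y) ℕ.* z + x ℕ.* w ≡ N)
canonical-spec N x y z w = mk⇔
  (λ t → let (pos , eq) = T-∧⁻ t ; (xy , zw) = T-∧⁻ pos ; (1≤x , 1≤y) = T-∧⁻ xy ; (1≤z , 1≤w) = T-∧⁻ zw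
         in ℕₚ.≤ᵇ⇒≤ 1 x 1≤x , ℕₚ.≤ᵇ⇒≤ 1 y 1≤y , ℕₚ.≤ᵇ⇒≤ 1 z 1≤z , ℕₚ.≤ᵇ⇒≤ 1 w 1≤w , ℕₚ.≡ᵇ⇒≡ _ N eq)
  (λ (1≤x , 1≤y , 1≤z , 1≤w , eq) →
     T-∧⁺ (T-∧⁺ (T-∧⁺ (ℕₚ.≤⇒≤ᵇ 1≤x , ℕₚ.≤⇒≤ᵇ 1≤y) , T-∧⁺ (ℕₚ.≤⇒≤ᵇ 1≤z , ℕₚ.≤⇒≤ᵇ 1≤w)) , ℕₚ.≡⇒≡ᵇ _ N eq))

used-up : ∀ n a b → (a ≤ n × b ≤ n ∸ a × n ∸ a ∸ b ≤ 0) ⇔ a + b ≡ n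
used-up n a b = mk⇔
  (λ (a≤n , b≤n-a , rest≤0) → trans (cong (λ e → a + e) (ℕₚ.≤-antisym b≤n-a (ℕₚ.m∸n≡0⇒m≤n (ℕₚ.n≤0⇒n≡0 rest≤0))))
                                    (ℕₚ.m+[n∸m]≡n a≤n))
  (λ { refl → ℕₚ.m≤m+n a b , ℕₚ.≤-reflexive (sym (ℕₚ.m+n∸m≡n a b))
            , ℕₚ.≤-reflexive (trans (cong (_∸ b) (ℕₚ.m+n∸m≡n a b)) (ℕₚ.n∸n≡0 b)) })

chain⇔canonical : ∀ N x y z w → T (chain N (x + y) z x w) ⇔ T (canonical N x y z w)
chain⇔canonical N x y z w = mk⇔
  (λ t → let (_ , (_ , 1≤z , uz≤N) , x<u , (1≤x , 1≤w , xw≤rest) , rest≤0) = to (chain-spec N (x + y) z x w) t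
         in from (canonical-spec N x y z w)
              (1≤x , positive-summand x<u , 1≤z , 1≤w , to (used-up N _ _) (uz≤N , xw≤rest , rest≤0)))
  (λ t → let (1≤x , 1≤y , 1≤z , 1≤w , eq) = to (canonical-spec N x y z w) t
             (uz≤N , xw≤rest , rest≤0) = from (used-up N _ _) eq
         in from (chain-spec N (x + y) z x w)
              ( s≤s (ℕₚ.≤-trans (ℕₚ.m≤m*n (x + y) z {{ℕ.>-nonZero 1≤z}}) uz≤N)
              , (ℕₚ.≤-trans 1≤x (ℕₚ.m≤m+n x y) , 1≤z , uz≤N) , ℕₚ.m<m+n x 1≤y , (1≤x , 1≤w , xw≤rest) , rest≤0))
  where
  open Equivalence
  positive-summand : ∀ {x y} → x < x + y → 1 ≤ y
  positive-summand {x} {zero}  x<x+0 = ⊥-elim (ℕₚ.<-irrefl (sym (ℕₚ.+-identityʳ x)) x<x+0)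
  positive-summand {x} {suc y} _     = s≤s ℕ.z≤n

depth-two-canonical : ∀ s₁ r₁ s₂ r₂ N →
  biBracket ((s₁ , r₁) ∷ (s₂ , r₂) ∷ []) N
  ≡ Σ⁴ (suc N) (λ x y z w → [ canonical N x y z w ]· weight s₁ r₁ (x + y) z * weight s₂ r₂ x w)
depth-two-canonical s₁ r₁ s₂ r₂ N =
  trans (bbCoeff₂-box s₁ r₁ s₂ r₂ N)
  (trans (chain-shift N (λ u v u′ v′ → weight s₁ r₁ u v * weight s₂ r₂ u′ v′))
         (Σ⁴-cong (suc N) (λ x y z w → []·-⇔ _ (chain⇔canonical N x y z w))))

-- The canonical guard is invariant under (x , y , z , w) ↦ (z , w , x , y),
-- as (z + w) x + z y = (x + y) z + x w.
canonical-swap : ∀ N x y z w → canonical N z w x y ≡ canonical N x y z w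
canonical-swap N x y z w = cong₂ _∧_ (∧-comm ((1 ≤ᵇ z) ∧ (1 ≤ᵇ w)) ((1 ≤ᵇ x) ∧ (1 ≤ᵇ y))) (cong (_≡ᵇ N) (swap-identity x y z w))
  where
  swap-identity : ∀ x y z w → (z + w) ℕ.* x + z ℕ.* y ≡ (x + y) ℕ.* z + x ℕ.* w
  swap-identity = solve-∀ℕ

depth-two-duality : ∀ s₁ s₂ r₁ r₂ →
  biBracket ((s₁ , r₁) ∷ (s₂ , r₂) ∷ [])
    ≐ sumSeries (suc r₁) (λ j → sumSeries (s₂ ∸ 1 + 1) (λ k →
        (sign k * ℕC (s₁ ∸ 1 + k) k * ℕC (r₂ + j) j)
          ·ₛ biBracket ((r₂ + 1 + j , s₂ ∸ 1 ∸ k) ∷ (r₁ + 1 ∸ j , s₁ ∸ 1 + k) ∷ [])))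
depth-two-duality s₁ s₂ r₁ r₂ N = begin
  biBracket ((s₁ , r₁) ∷ (s₂ , r₂) ∷ []) N
    ≡⟨ depth-two-canonical s₁ r₁ s₂ r₂ N ⟩
  Σ⁴ M (λ x y z w → [ canonical N x y z w ]· weight s₁ r₁ (x + y) z * weight s₂ r₂ x w)
    ≡⟨ Σ⁴-rotate M _ ⟩
  Σ⁴ M (λ x y z w → [ canonical N z w x y ]· weight s₁ r₁ (z + w) x * weight s₂ r₂ z y)
    ≡⟨ Σ⁴-cong M (λ x y z w → cong₂ [_]·_ (canonical-swap N x y z w) (weight-expansion s₁ r₁ s₂ r₂ x y z w)) ⟩
  Σ⁴ M (λ x y z w → [ canonical N x y z w ]· sumBelow (suc r₁) (λ j → sumBelow K (λ k → c j k * dual j k x y z w)))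
    ≡⟨ sym (Σ⁴-linear (suc r₁) K M c (canonical N) dual) ⟩
  sumBelow (suc r₁) (λ j → sumBelow K (λ k → c j k * Σ⁴ M (λ x y z w → [ canonical N x y z w ]· dual j k x y z w)))
    ≡⟨ sum-cong (suc r₁) (λ j → sum-cong K (λ k → cong (c j k *_)
         (sym (depth-two-canonical (r₂ + 1 + j) (s₂ ∸ 1 ∸ k) (r₁ + 1 ∸ j) (s₁ ∸ 1 + k) N)))) ⟩
  sumBelow (suc r₁) (λ j → sumBelow K (λ k → c j k * biBracket ((r₂ + 1 + j , s₂ ∸ 1 ∸ k) ∷ (r₁ + 1 ∸ j , s₁ ∸ 1 + k) ∷ []) N)) ∎
  where
  open ≡-Reasoning
  M = suc N
  K = s₂ ∸ 1 + 1
  c : ℕ → ℕ → ℚ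
  c j k = sign k * ℕC (s₁ ∸ 1 + k) k * ℕC (r₂ + j) j
  dual : ℕ → ℕ → ℕ → ℕ → ℕ → ℕ → ℚ
  dual j k x y z w = weight (r₂ + 1 + j) (s₂ ∸ 1 ∸ k) (x + y) z * weight (r₁ + 1 ∸ j) (s₁ ∸ 1 + k) x w

mainTheorem10 :
    ((s r : ℕ) → 0 < s →
      biBracket ((s , r) ∷ []) ≐ biBracket ((r + 1 , s ∸ 1) ∷ []))
    ×
    ((s₁ s₂ r₁ r₂ : ℕ) → 0 < s₁ → 0 < s₂ →
      biBracket ((s₁ , r₁) ∷ (s₂ , r₂) ∷ [])
        ≐ sumSeries (suc r₁) (λ j → sumSeries (s₂ ∸ 1 + 1) (λ k →
            (sign k * ℕC (s₁ ∸ 1 + k) k * ℕC (r₂ + j) j)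
              ·ₛ biBracket ((r₂ + 1 + j , s₂ ∸ 1 ∸ k) ∷ (r₁ + 1 ∸ j , s₁ ∸ 1 + k) ∷ []))))
mainTheorem10 = (λ s r _ → depth-one-duality s r)
              , (λ s₁ s₂ r₁ r₂ _ _ → depth-two-duality s₁ s₂ r₁ r₂)
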